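{- Let $G$ be a permutation group on a set $\Omega$ that has a regular subgroup $R$ of index $2$. Then $G$ is $2$-closed.
   Context: A subgroup $R$ of a permutation group is regular if it acts transitively on $\Omega$ and the only element of $R$ fixing a point is the identity. The $2$-closure $G^{(2)}$ of a permutation group $G$ on $\Omega$ is the set of all permutations $z$ of $\Omega$ such that for every pair $(\alpha,\beta)\in\Omega\times\Omega$ there exists $h \in G$ with $(\alpha,\beta)^z = (\alpha^h,\beta^h)$, i.e. the largest permutation group on $\Omega$ with the same orbits on $\Omega\times\Omega$ as $G$. The group $G$ is $2$-closed if $G^{(2)} = G$. -}

module Defs where

open import Data.Nat.Base using (ℕ)
open import Data.Fin.Base using (Fin)
open import Data.Fin.Permutation
  using (Permutation′; _⟨$⟩ʳ_; _≈_; id; flip; _∘ₚ_)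
open import Data.Product.Base using (Σ; _×_; _,_)
open import Data.Sum.Base using (_⊎_)
open import Relation.Binary.PropositionalEquality using (_≡_)
open import Relation.Nullary using (¬_)

-- Permutations of the finite set Ω = Fin n.
-- Note: (π ∘ₚ ρ) applies π first, then ρ (right actions, as in α^{πρ}).
Perm : ℕ → Set
Perm n = Permutation′ n

record PermGroup (n : ℕ) : Set₁ where
  field
    _∈G   : Perm n → Set
    resp  : ∀ {π ρ} → π ≈ ρ → π ∈G → ρ ∈G
    id∈   : id ∈G
    ∘∈    : ∀ {π ρ} → π ∈G → ρ ∈G → (π ∘ₚ ρ) ∈G
    inv∈  : ∀ {π} → π ∈G → flip π ∈G
open PermGroup public

_∈_ : ∀ {n} → Perm n → PermGroup n → Set
π ∈ G = _∈G G π

_≤G_ : ∀ {n} → PermGroup n → PermGroup n → Set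
H ≤G G = ∀ π → π ∈ H → π ∈ G

Transitive : ∀ {n} → PermGroup n → Set
Transitive {n} R = ∀ (α β : Fin n) → Σ (Perm n) λ r → r ∈ R × (r ⟨$⟩ʳ α ≡ β)

Semiregular : ∀ {n} → PermGroup n → Set
Semiregular {n} R = ∀ r → r ∈ R → ∀ (α : Fin n) → r ⟨$⟩ʳ α ≡ α → r ≈ id

Regular : ∀ {n} → PermGroup n → Set
Regular R = Transitive R × Semiregular R

-- R is a subgroup of G of index 2: R ≤ G and G has exactly two cosets
-- (right) cosets of R, namely R and R g for some g ∈ G ∖ R
-- (h ∈ R g  iff  h g⁻¹ ∈ R, i.e.  (h ∘ₚ flip g) ∈ R ).
Index2 : ∀ {n} → PermGroup n → PermGroup n → Set
Index2 {n} R G =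
  R ≤G G × Σ (Perm n) λ g → g ∈ G × ¬ (g ∈ R) ×
           (∀ h → h ∈ G → h ∈ R ⊎ (h ∘ₚ flip g) ∈ R)

InTwoClosure : ∀ {n} → PermGroup n → Perm n → Set
InTwoClosure {n} G z = ∀ (α β : Fin n) →
  Σ (Perm n) λ h → h ∈ G × (z ⟨$⟩ʳ α ≡ h ⟨$⟩ʳ α) × (z ⟨$⟩ʳ β ≡ h ⟨$⟩ʳ β)

TwoClosed : ∀ {n} → PermGroup n → Set
TwoClosed {n} G = ∀ (z : Perm n) → (InTwoClosure G z → z ∈ G) × (z ∈ G → InTwoClosure G z)

{-# OPTIONS --safe #-}
-- Choose t ∈ G fixing a point α, so that G = R ∪ Rt. Semiregularity of R makes each element of
-- G determined by its value at a single point once its coset is known, so an element of G that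
-- fixes a point x and agrees with t at a point y is 1 or t; in particular G_α = {1, t}. An
-- element w of G^(2) fixing α agrees at every point with 1 or t. If w moves β, then for any
-- fixed point γ of w some h ∈ G fixes γ and sends β to tβ; h ≠ 1 forces h = t, so tγ = γ = wγ
-- and w = t. Thus G^(2)_α ⊆ G, and G^(2) = G^(2)_α G since G^(2) and G have the same orbits.
module Submission where

open import Defs
open import Data.Nat.Base using (ℕ; zero; suc)
open import Data.Fin.Base as Fin using (Fin)
open import Data.Fin.Properties using (_≟_; all?; ¬∀⟶∃¬)
open import Data.Fin.Permutation
  using (_⟨$⟩ʳ_; _⟨$⟩ˡ_; inverseˡ; inverseʳ; _≈_; id; flip; _∘ₚ_)
open import Data.Product.Base using (Σ; _×_; _,_)
import Data.Sum.Base as Sum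
open import Data.Sum.Base using (_⊎_; inj₁; inj₂)
open import Relation.Nullary using (yes; no; contradiction)
open import Relation.Binary.PropositionalEquality
  using (_≡_; refl; sym; trans; cong; module ≡-Reasoning)

module _ {n : ℕ} where

  ∈⇒InTwoClosure : (G : PermGroup n) {z : Perm n} → z ∈ G → InTwoClosure G z
  ∈⇒InTwoClosure G {z} z∈G _ _ = z , z∈G , refl , refl

  InTwoClosure-∘ₚ : (G : PermGroup n) {z h : Perm n} →
                    InTwoClosure G z → h ∈ G → InTwoClosure G (z ∘ₚ h)
  InTwoClosure-∘ₚ G {h = h} z∈G² h∈G α β with z∈G² α β
  ... | k , k∈G , zα≡kα , zβ≡kβ =
    k ∘ₚ h , ∘∈ G k∈G h∈G , cong (h ⟨$⟩ʳ_) zα≡kα , cong (h ⟨$⟩ʳ_) zβ≡kβ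

  twoClosed-fromStabiliser : (G : PermGroup n) (α : Fin n) →
    (∀ w → InTwoClosure G w → w ⟨$⟩ʳ α ≡ α → w ∈ G) → TwoClosed G
  twoClosed-fromStabiliser G α stabiliser⊆G z = twoClosure⊆G , ∈⇒InTwoClosure G
    where
    twoClosure⊆G : InTwoClosure G z → z ∈ G
    twoClosure⊆G z∈G² with z∈G² α α
    ... | h , h∈G , zα≡hα , _ = resp G (λ _ → inverseʳ h) (∘∈ G zh⁻¹∈G h∈G)
      where
      zh⁻¹∈G : (z ∘ₚ flip h) ∈ G
      zh⁻¹∈G = stabiliser⊆G _ (InTwoClosure-∘ₚ G {z} z∈G² (inv∈ G h∈G))
                              (trans (cong (h ⟨$⟩ˡ_) zα≡hα) (inverseˡ h))

  TwoCosets : PermGroup n → PermGroup n → Perm n → Set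
  TwoCosets R G t = ∀ h → h ∈ G → h ∈ R ⊎ (h ∘ₚ flip t) ∈ R

  TwoCosets-∘ₚ : (R G : PermGroup n) (g : Perm n) {r : Perm n} →
                 TwoCosets R G g → r ∈ R → TwoCosets R G (r ∘ₚ g)
  TwoCosets-∘ₚ R G g cover r∈R h h∈G with cover h h∈G
  ... | inj₁ h∈R    = inj₁ h∈R
  ... | inj₂ hg⁻¹∈R = inj₂ (resp R (λ _ → refl) (∘∈ R hg⁻¹∈R (inv∈ R r∈R)))

  index2⇒TwoCosets-fixing : (R G : PermGroup n) → Transitive R → Index2 R G → (α : Fin n) →
    Σ (Perm n) λ t → t ∈ G × t ⟨$⟩ʳ α ≡ α × TwoCosets R G t
  index2⇒TwoCosets-fixing R G transitive (R≤G , g , g∈G , _ , cover) α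
    with transitive α (flip g ⟨$⟩ʳ α)
  ... | r , r∈R , rα≡g⁻¹α =
    r ∘ₚ g , ∘∈ G (R≤G r r∈R) g∈G , trans (cong (g ⟨$⟩ʳ_) rα≡g⁻¹α) (inverseʳ g) ,
    TwoCosets-∘ₚ R G g cover r∈R

  semiregular-sameCoset-agree⇒≈ : (R : PermGroup n) → Semiregular R →
    (h k : Perm n) {x : Fin n} → (h ∘ₚ flip k) ∈ R → h ⟨$⟩ʳ x ≡ k ⟨$⟩ʳ x → h ≈ k
  semiregular-sameCoset-agree⇒≈ R semiregular h k {x} hk⁻¹∈R hx≡kx i = begin
    h ⟨$⟩ʳ i                     ≡⟨ inverseʳ k ⟨
    k ⟨$⟩ʳ (k ⟨$⟩ˡ (h ⟨$⟩ʳ i))   ≡⟨ cong (k ⟨$⟩ʳ_) (semiregular _ hk⁻¹∈R x hk⁻¹x≡x i) ⟩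
    k ⟨$⟩ʳ i                     ∎
    where
    open ≡-Reasoning
    hk⁻¹x≡x : k ⟨$⟩ˡ (h ⟨$⟩ʳ x) ≡ x
    hk⁻¹x≡x = trans (cong (k ⟨$⟩ˡ_) hx≡kx) (inverseˡ k)

  Rigid : PermGroup n → Perm n → Set
  Rigid G t = ∀ {h : Perm n} {x y : Fin n} →
              h ∈ G → h ⟨$⟩ʳ x ≡ x → h ⟨$⟩ʳ y ≡ t ⟨$⟩ʳ y → h ≈ id ⊎ h ≈ t

  semiregular-TwoCosets⇒Rigid : (R G : PermGroup n) (t : Perm n) →
                                Semiregular R → TwoCosets R G t → Rigid G t
  semiregular-TwoCosets⇒Rigid R G t semiregular cover {h} h∈G hx≡x hy≡ty with cover h h∈G
  ... | inj₁ h∈R    = inj₁ (semiregular h h∈R _ hx≡x)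
  ... | inj₂ ht⁻¹∈R = inj₂ (semiregular-sameCoset-agree⇒≈ R semiregular h t ht⁻¹∈R hy≡ty)

  module _ (G : PermGroup n) (t : Perm n) (rigid : Rigid G t)
           {α : Fin n} (tα≡α : t ⟨$⟩ʳ α ≡ α) where

    rigid-stabiliser : ∀ {h : Perm n} → h ∈ G → h ⟨$⟩ʳ α ≡ α → h ≈ id ⊎ h ≈ t
    rigid-stabiliser h∈G hα≡α = rigid h∈G hα≡α (trans hα≡α (sym tα≡α))

    twoClosure-stabiliser-pointwise : ∀ w → InTwoClosure G w → w ⟨$⟩ʳ α ≡ α →
                                      ∀ β → w ⟨$⟩ʳ β ≡ β ⊎ w ⟨$⟩ʳ β ≡ t ⟨$⟩ʳ β
    twoClosure-stabiliser-pointwise w w∈G² wα≡α β with w∈G² α β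
    ... | h , h∈G , wα≡hα , wβ≡hβ =
      Sum.map (λ h≈id → trans wβ≡hβ (h≈id β)) (λ h≈t → trans wβ≡hβ (h≈t β))
              (rigid-stabiliser h∈G (trans (sym wα≡hα) wα≡α))

    twoClosure-stabiliser : ∀ w → InTwoClosure G w → w ⟨$⟩ʳ α ≡ α → w ≈ id ⊎ w ≈ t
    twoClosure-stabiliser w w∈G² wα≡α with all? (λ β → w ⟨$⟩ʳ β ≟ β)
    ... | yes w≈id = inj₁ w≈id
    ... | no w≉id with ¬∀⟶∃¬ n _ (λ β → w ⟨$⟩ʳ β ≟ β) w≉id
    ... | β , wβ≢β = inj₂ w≈t
      where
      wβ≡tβ : w ⟨$⟩ʳ β ≡ t ⟨$⟩ʳ β
      wβ≡tβ = Sum.[ (λ wβ≡β → contradiction wβ≡β wβ≢β) , (λ wβ≡tβ → wβ≡tβ) ]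
                (twoClosure-stabiliser-pointwise w w∈G² wα≡α β)

      w≈t : w ≈ t
      w≈t γ with twoClosure-stabiliser-pointwise w w∈G² wα≡α γ
      ... | inj₂ wγ≡tγ = wγ≡tγ
      ... | inj₁ wγ≡γ with w∈G² γ β
      ... | h , h∈G , wγ≡hγ , wβ≡hβ
          with rigid h∈G (trans (sym wγ≡hγ) wγ≡γ) (trans (sym wβ≡hβ) wβ≡tβ)
      ... | inj₁ h≈id = contradiction (trans wβ≡hβ (h≈id β)) wβ≢β
      ... | inj₂ h≈t  = trans wγ≡hγ (h≈t γ)

lemma2p2 : (n : ℕ) (G R : PermGroup n) → Regular R → Index2 R G → TwoClosed G
lemma2p2 zero G R _ _ z = (λ _ → resp G (λ ()) (id∈ G)) , ∈⇒InTwoClosure G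
lemma2p2 (suc m) G R (transitive , semiregular) index2
  with index2⇒TwoCosets-fixing R G transitive index2 Fin.zero
... | t , t∈G , tα≡α , cover = twoClosed-fromStabiliser G Fin.zero stabiliser⊆G
  where
  rigid : Rigid G t
  rigid = semiregular-TwoCosets⇒Rigid R G t semiregular cover

  stabiliser⊆G : ∀ w → InTwoClosure G w → w ⟨$⟩ʳ Fin.zero ≡ Fin.zero → w ∈ G
  stabiliser⊆G w w∈G² wα≡α with twoClosure-stabiliser G t rigid tα≡α w w∈G² wα≡α
  ... | inj₁ w≈id = resp G (λ i → sym (w≈id i)) (id∈ G)
  ... | inj₂ w≈t  = resp G (λ i → sym (w≈t i)) t∈G
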